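{- Let $\mathcal A=(Q,\Sigma,\delta,s,F)$ be a DFA satisfying the standing assumptions below, let $k\ge0$, let $u\in Q$, and let $v_1,v_2\in P_k(u)$ with $v_1\neq v_2$. Then $P_k(v_1)\cap P_k(v_2)=\emptyset$.
   Context: A DFA is $\mathcal A=(Q,\Sigma,\delta,s,F)$ with finite state set $Q$, finite totally ordered alphabet $\Sigma$, (partial) deterministic transition function $\delta$ extended to words, initial state $s$, final states $F$. Standing assumptions: $s$ has no incoming transitions; every state is reachable from $s$; all transitions entering a state $u$ carry the same label $\lambda(u)$. $\delta^{ -1}(u)=\{v\in Q:\exists a,\ \delta(v,a)=u\}$. $I_q=\{\alpha\in\Sigma^*:\delta(s,\alpha)=q\}$; co-lex order on finite and left-infinite strings: $\epsilon<\alpha$ for nonempty $\alpha$; for $\alpha=\alpha'a$, $\beta=\beta'b$, $\alpha<\beta$ iff $a<b$, or $a=b$ and $\alpha'<\beta'$; $\inf I_u$ is the greatest lower bound of $I_u$. $suf_k(\alpha)$ is the length-$k$ suffix of $\alpha$, left-padded with copies of a symbol $\#<\Sigma$ if $|\alpha|<k$. $\gamma\sqsubseteq\eta$ means $\gamma$ is a prefix of $\eta$. The extender sets are: $P_0(u)=\{v\in\delta^{ -1}(u):\forall v'\in\delta^{ -1}(u),\ \lambda(v)\le\lambda(v')\}$, and for $k>0$, $P_k(u)=\{v\in Q:\delta(v,suf_{2^k}(\inf I_u))=u\ \text{and}\ suf_{2^k}(\inf I_v)\sqsubseteq suf_{2^{k+1}}(\inf I_u)\}$. -}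

module Defs where

open import Data.Nat using (ℕ; zero; suc; _^_)
open import Data.Bool using (Bool)
import Data.Nat as ℕ
open import Data.Fin using (Fin)
import Data.Fin as Fin
open import Data.Maybe using (Maybe; just; nothing)
open import Data.List using (List; []; _∷_; _++_; reverse; map; upTo)
open import Data.Product using (Σ; ∃; _×_; _,_)
open import Data.Sum using (_⊎_)
open import Relation.Binary.PropositionalEquality using (_≡_; _≢_)

record DFA (n m : ℕ) : Set where
  field
    δ : Fin n → Fin m → Maybe (Fin n)
    s : Fin n
    F : Fin n → Bool

module _ {n m : ℕ} (A : DFA n m) where
  open DFA A

  δ* : Fin n → List (Fin m) → Maybe (Fin n)
  δ* q []      = just q
  δ* q (a ∷ α) with δ q a
  ... | nothing = nothing
  ... | just q' = δ* q' α

  I : Fin n → List (Fin m) → Set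
  I q α = δ* s α ≡ just q

  Lab : Fin n → Fin m → Set
  Lab v a = ∃ λ q → δ q a ≡ just v

  record Standing : Set where
    field
      s-no-incoming   : ∀ q a → δ q a ≢ just s
      all-reachable   : ∀ q → ∃ λ α → I q α
      input-consistent : ∀ v a b → Lab v a → Lab v b → a ≡ b

-- Symbols extended with the padding symbol # (= nothing), # < Σ.

data _≤M_ {m : ℕ} : Maybe (Fin m) → Maybe (Fin m) → Set where
  #≤    : ∀ {x} → nothing ≤M x
  just≤ : ∀ {a b} → a Fin.≤ b → just a ≤M just b

data _<M_ {m : ℕ} : Maybe (Fin m) → Maybe (Fin m) → Set where
  #<    : ∀ {a} → nothing <M just a
  just< : ∀ {a b} → a Fin.< b → just a <M just b

-- Finite and left-infinite strings, read from the right: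
-- x i is the i-th symbol counted from the right end (i = 0 is the last
-- symbol); nothing means "the string has ended".  A finite string α is
-- the stream with x i = nothing for i ≥ |α|.

Str : ℕ → Set
Str m = ℕ → Maybe (Fin m)

ValidStr : ∀ {m} → Str m → Set
ValidStr x = ∀ i → x i ≡ nothing → x (suc i) ≡ nothing

toStr : ∀ {m} → List (Fin m) → Str m
toStr α = go (reverse α)
  where
  go : ∀ {m} → List (Fin m) → Str m
  go []      _       = nothing
  go (a ∷ β) zero    = just a
  go (a ∷ β) (suc i) = go β i

-- co-lex order (comparison from the right end, ε below everything)
_≈S_ : ∀ {m} → Str m → Str m → Set
x ≈S y = ∀ i → x i ≡ y i

_<S_ : ∀ {m} → Str m → Str m → Set
x <S y = ∃ λ i → (∀ j → j ℕ.< i → x j ≡ y j) × (x i <M y i)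

_≤S_ : ∀ {m} → Str m → Str m → Set
x ≤S y = x ≈S y ⊎ x <S y

IsInf : ∀ {m} → (List (Fin m) → Set) → Str m → Set
IsInf {m} S g =
  ValidStr g ×
  (∀ α → S α → g ≤S toStr α) ×
  (∀ (y : Str m) → ValidStr y → (∀ α → S α → y ≤S toStr α) → y ≤S g)

-- suf_k : length-k suffix, left-padded with # (= nothing)
suf : ∀ {m} → ℕ → Str m → List (Maybe (Fin m))
suf k x = reverse (map x (upTo k))

_⊑_ : ∀ {A : Set} → List A → List A → Set
γ ⊑ η = ∃ λ t → γ ++ t ≡ η

module _ {n m : ℕ} (A : DFA n m) where
  open DFA A

  δ# : Fin n → List (Maybe (Fin m)) → Maybe (Fin n)
  δ# q []             = just q
  δ# q (nothing ∷ w)  = nothing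
  δ# q (just a ∷ w) with δ q a
  ... | nothing = nothing
  ... | just q' = δ# q' w

  IsLam : Fin n → Maybe (Fin m) → Set
  IsLam v x = (v ≡ s × x ≡ nothing) ⊎ (∃ λ a → Lab A v a × x ≡ just a)

  Pred : Fin n → Fin n → Set
  Pred u v = ∃ λ a → δ v a ≡ just u

  -- extender sets P_k(u), given inf : Q → strings with inf u = inf I_u
  P : (inf : Fin n → Str m) → ℕ → Fin n → Fin n → Set
  P inf zero u v =
    Pred u v ×
    (∀ v' → Pred u v' → ∀ x x' → IsLam v x → IsLam v' x' → x ≤M x')
  P inf (suc k') u v =
    δ# v (suf (2 ^ k) (inf u)) ≡ just u ×
    suf (2 ^ k) (inf v) ⊑ suf (2 ^ suc k) (inf u)
    where k = suc k'

-- For k = 0 they are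
-- both entered with the least label of u, so the edges from w into them carry
-- the same letter and determinism forces them equal.  For k > 0 their length-2^k
-- suffixes are both prefixes of the same string, hence equal, and reading that
-- one word from w leads to both.  Neither case uses the standing assumptions or
-- that inf computes the infima.
module Submission where

open import Defs
open import Data.Nat using (ℕ; zero; suc; pred; _^_)
open import Data.Fin using (Fin)
open import Data.Fin.Properties using (≤-antisym)
open import Data.List using (List; []; _∷_; length; map; upTo)
open import Data.List.Properties using (∷-injective; length-reverse; length-map; length-upTo)
open import Data.Maybe using (Maybe; just)
open import Data.Maybe.Properties using (just-injective)
open import Data.Product using (_×_; _,_)
open import Data.Sum using (inj₂)
open import Relation.Nullary using (¬_)
open import Relation.Binary.PropositionalEquality

⊑-unique-by-length : ∀ {A : Set} {γ γ' η : List A} →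
                     γ ⊑ η → γ' ⊑ η → length γ ≡ length γ' → γ ≡ γ'
⊑-unique-by-length {γ = []}    {[]}     _ _ _ = refl
⊑-unique-by-length {γ = x ∷ γ} {y ∷ γ'} (t , refl) (t' , e') l
  with y≡x , tail ← ∷-injective e' =
  cong₂ _∷_ (sym y≡x) (⊑-unique-by-length (t , refl) (t' , tail) (cong pred l))

length-suf : ∀ {m} k (x : Str m) → length (suf k x) ≡ k
length-suf k x = begin
  length (suf k x)              ≡⟨ length-reverse (map x (upTo k)) ⟩
  length (map x (upTo k))       ≡⟨ length-map x (upTo k) ⟩
  length (upTo k)               ≡⟨ length-upTo k ⟩
  k                             ∎
  where open ≡-Reasoning

module _ {n m : ℕ} (A : DFA n m) where
  open DFA A

  δ-deterministic : ∀ {w v₁ v₂ : Fin n} {a : Fin m} →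
                    δ w a ≡ just v₁ → δ w a ≡ just v₂ → v₁ ≡ v₂
  δ-deterministic e₁ e₂ = just-injective (trans (sym e₁) e₂)

  δ#-deterministic : ∀ (w : Fin n) {v₁ v₂ : Fin n} {α β : List (Maybe (Fin m))} →
                     α ≡ β → δ# A w α ≡ just v₁ → δ# A w β ≡ just v₂ → v₁ ≡ v₂
  δ#-deterministic w refl e₁ e₂ = just-injective (trans (sym e₁) e₂)

  P₀-label-unique : ∀ {inf u v₁ v₂ a b} → P A inf zero u v₁ → P A inf zero u v₂ →
                    Lab A v₁ a → Lab A v₂ b → a ≡ b
  P₀-label-unique (pred₁ , least₁) (pred₂ , least₂) lab₁ lab₂
    with least₁ _ pred₂ _ _ (inj₂ (_ , lab₁ , refl)) (inj₂ (_ , lab₂ , refl))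
       | least₂ _ pred₁ _ _ (inj₂ (_ , lab₂ , refl)) (inj₂ (_ , lab₁ , refl))
  ... | just≤ a≤b | just≤ b≤a = ≤-antisym a≤b b≤a

lemma17 : ∀ {n m : ℕ} (A : DFA n m) → Standing A →
    (inf : Fin n → Str m) → (∀ u → IsInf (I A u) (inf u)) →
    ∀ (k : ℕ) (u v₁ v₂ : Fin n) → P A inf k u v₁ → P A inf k u v₂ → v₁ ≢ v₂ →
    ∀ (w : Fin n) → ¬ (P A inf k v₁ w × P A inf k v₂ w)
lemma17 A _ inf _ zero u v₁ v₂ p₁ p₂ v₁≢v₂ w (((a , e₁) , _) , ((b , e₂) , _))
  with refl ← P₀-label-unique A {inf} p₁ p₂ (w , e₁) (w , e₂) =
  v₁≢v₂ (δ-deterministic A e₁ e₂)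
lemma17 A _ inf _ (suc k) u v₁ v₂ (_ , suf₁⊑) (_ , suf₂⊑) v₁≢v₂ w ((reach₁ , _) , (reach₂ , _)) =
  v₁≢v₂ (δ#-deterministic A w same-suffix reach₁ reach₂)
  where
  same-suffix : suf (2 ^ suc k) (inf v₁) ≡ suf (2 ^ suc k) (inf v₂)
  same-suffix = ⊑-unique-by-length suf₁⊑ suf₂⊑
                  (trans (length-suf (2 ^ suc k) (inf v₁)) (sym (length-suf (2 ^ suc k) (inf v₂))))
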